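{- For every proper interval graph $G$ all of whose connected components have an even number of vertices, $\chi_{\operatorname{odd}}(G)\le 3$.
   Context: A graph is odd if every vertex has odd degree (the empty graph counts as odd). A $k$-odd colouring of $G$ is a partition of $V(G)$ into $k$ (possibly empty) parts each inducing an odd subgraph; $\chi_{\operatorname{odd}}(G)$ is the least such $k$. A proper interval graph is the intersection graph of a finite family of closed real intervals none of which properly contains another.
   Formalization: The intervals representing a proper interval graph have rational endpoints rather than real ones. -}

module Defs where

open import Data.Nat using (ℕ; zero; suc; _+_)
open import Data.Nat.Divisibility using (_∣_)
open import Data.Fin using (Fin; zero; suc; _≟_)
open import Data.Bool using (Bool; true; false; _∧_; if_then_else_)
open import Data.Product using (Σ; _×_; ∃)
open import Data.Fin.Subset using (Subset; _∈_; ∣_∣)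
open import Data.Rational using (ℚ; _≤_)
open import Relation.Nullary using (¬_; does)
open import Relation.Binary.PropositionalEquality using (_≡_; _≢_)
open import Function.Bundles using (_⇔_)

record Graph (n : ℕ) : Set where
  field
    adj   : Fin n → Fin n → Bool
    sym   : ∀ u v → adj u v ≡ adj v u
    irref : ∀ v → adj v v ≡ false
open Graph public

countB : ∀ {n} → (Fin n → Bool) → ℕ
countB {zero}  p = 0
countB {suc n} p = (if p zero then 1 else 0) + countB (λ i → p (suc i))

Odd : ℕ → Set
Odd m = ¬ (2 ∣ m)

-- A k-odd colouring: a partition of V(G) into k (possibly empty) parts
-- c⁻¹(0), …, c⁻¹(k-1), each inducing an odd subgraph, i.e. every vertex
-- has an odd number of neighbours in its own part.
IsOddColouring : ∀ {n} (G : Graph n) (k : ℕ) → (Fin n → Fin k) → Set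
IsOddColouring G k c =
  ∀ v → Odd (countB (λ u → adj G v u ∧ does (c u ≟ c v)))

χodd≤ : ∀ {n} → Graph n → ℕ → Set
χodd≤ {n} G k = Σ ℕ λ j → (j Data.Nat.≤ k) × Σ (Fin n → Fin j) (IsOddColouring G j)

data Reach {n} (G : Graph n) : Fin n → Fin n → Set where
  here  : ∀ {v} → Reach G v v
  step  : ∀ {u v w} → adj G u v ≡ true → Reach G v w → Reach G u w

IsComponent : ∀ {n} → Graph n → Subset n → Set
IsComponent G S =
  (∃ λ v → v ∈ S) ×
  (∀ u v → u ∈ S → adj G u v ≡ true → v ∈ S) ×
  (∀ u v → u ∈ S → v ∈ S → Reach G u v)

IsProperIntervalGraph : ∀ {n} → Graph n → Set
IsProperIntervalGraph {n} G =
  Σ (Fin n → ℚ) λ l → Σ (Fin n → ℚ) λ r →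
    (∀ i → l i ≤ r i) ×
    (∀ i j → (adj G i j ≡ true) ⇔ (i ≢ j × l i ≤ r j × l j ≤ r i)) ×
    (∀ i j → l i ≤ l j → r j ≤ r i → (l i ≡ l j × r i ≡ r j))

module Submission where

-- Order the vertices by left endpoint.  Because no interval properly contains another, this
-- order has the umbrella property (i ≺ k ≺ j and i ~ j imply i ~ k and k ~ j), so the closed
-- upper neighbourhood N⁺ s of a vertex s is a clique and an initial segment of {u | s ≼ u}.
-- Cut the vertices greedily into consecutive blocks: starting from the least vertex s not yet
-- covered, take N⁺ s, dropping its largest element when |N⁺ s| is odd.  Each block is an even
-- clique, so its vertices have odd degree inside it.  A block always contains its start s:
-- otherwise s would have no neighbour above it, so the vertices up to s would form a union of
-- components and be even in number, yet they are one more than the evenly many below s.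
-- A neighbour of a block lying beyond it is in N⁺ of the next start, i.e. in one of the next
-- two blocks, so colouring the blocks cyclically with three colours leaves every vertex with
-- exactly its own block minus itself as same-coloured neighbours.

open import Data.Bool using (Bool; true; false; if_then_else_)
open import Data.Bool.Properties using (T-≡)
open import Data.Fin using (Fin; zero; suc; _≟_; _<_)
open import Data.Fin.Induction using (spo-wellFounded; spo-noetherian)
open import Data.Fin.Properties as FinP using (any?)
open import Data.Fin.Subset using (Subset; ∣_∣) renaming (_∈_ to _∈ₛ_)
open import Data.Nat using (ℕ; zero; suc; _+_; _≤_; z≤n; s≤s)
open import Data.Nat.Divisibility using (_∣_; _∣?_; _∣0; ∣-refl; ∣m∣n⇒∣m+n; ∣m+n∣m⇒∣n; ∣1⇒≡1)
open import Data.Nat.Properties using (≤-refl; ≤-antisym; m≤n⇒m≤1+n; +-suc; +-comm)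
open import Data.Product using (∃; ∄; _×_; _,_; proj₁; proj₂)
open import Data.Product.Relation.Binary.Lex.Strict using (×-compare)
open import Data.Rational as ℚ using (ℚ)
import Data.Rational.Properties as ℚP
open import Data.Sum using (_⊎_; inj₁; inj₂)
open import Data.Vec using (tabulate)
open import Data.Vec.Properties using (lookup∘tabulate; []=⇒lookup; lookup⇒[]=)
open import Function using (_∘_; flip)
open import Function.Bundles using (Equivalence)
open import Induction.WellFounded using (WellFounded; Acc; acc)
open import Level using (0ℓ)
open import Relation.Binary
  using (Rel; IsStrictTotalOrder; Irreflexive; Transitive; Trichotomous; tri<; tri≈; tri>)
open import Relation.Binary.PropositionalEquality
  using (_≡_; _≢_; refl; sym; trans; cong; cong₂; subst; isEquivalence; resp₂; module ≡-Reasoning)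
open import Relation.Nullary using (¬_; Dec; yes; no; does; contradiction)
import Relation.Nullary.Decidable as Dec
open import Relation.Nullary.Decidable
  using (T?; _×-dec_; _⊎-dec_; ¬?; dec-true; dec-false; decidable-stable)
open import Relation.Unary using (Pred; Decidable; _⊆_; _≐_; _∩_; ∁; Empty)
open import Relation.Unary.Properties using (U?; _∩?_; ∁?)

open import Defs renaming (sym to adj-sym; irref to adj-irrefl)

count : ∀ {n} {P : Pred (Fin n) 0ℓ} → Decidable P → ℕ
count P? = countB (λ u → does (P? u))

count-mono : ∀ {n} {P Q : Pred (Fin n) 0ℓ} (P? : Decidable P) (Q? : Decidable Q) →
             P ⊆ Q → count P? ≤ count Q?
count-mono {zero}  P? Q? P⊆Q = z≤n
count-mono {suc n} P? Q? P⊆Q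
  with P? zero | Q? zero | count-mono (λ u → P? (suc u)) (λ u → Q? (suc u)) P⊆Q
... | yes _ | yes _ | le = s≤s le
... | yes p | no ¬q | _  = contradiction (P⊆Q p) ¬q
... | no _  | yes _ | le = m≤n⇒m≤1+n le
... | no _  | no _  | le = le

count-cong : ∀ {n} {P Q : Pred (Fin n) 0ℓ} (P? : Decidable P) (Q? : Decidable Q) →
             P ≐ Q → count P? ≡ count Q?
count-cong P? Q? (P⊆Q , Q⊆P) = ≤-antisym (count-mono P? Q? P⊆Q) (count-mono Q? P? Q⊆P)

count-empty : ∀ {n} {P : Pred (Fin n) 0ℓ} (P? : Decidable P) → Empty P → count P? ≡ 0
count-empty {zero}  P? ∅ = refl
count-empty {suc n} P? ∅ with P? zero
... | yes p = contradiction p (∅ zero)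
... | no _  = count-empty (λ u → P? (suc u)) (λ u → ∅ (suc u))

count-split : ∀ {n} {P Q : Pred (Fin n) 0ℓ} (P? : Decidable P) (Q? : Decidable Q) →
              count P? ≡ count (P? ∩? Q?) + count (P? ∩? ∁? Q?)
count-split {zero}  P? Q? = refl
count-split {suc n} P? Q?
  with P? zero | Q? zero | count-split (λ u → P? (suc u)) (λ u → Q? (suc u))
... | yes _ | yes _ | eq = cong suc eq
... | yes _ | no _  | eq = trans (cong suc eq) (sym (+-suc _ _))
... | no _  | _     | eq = eq

count-remove : ∀ {n} {P : Pred (Fin n) 0ℓ} (P? : Decidable P) {v} → P v →
               count P? ≡ suc (count (P? ∩? ∁? (_≟ v)))
count-remove {suc n} P? {zero} p with P? zero
... | yes _ = cong suc (count-cong (λ u → P? (suc u)) (λ u → (P? ∩? ∁? (_≟ zero)) (suc u))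
                                   ((λ q → q , λ ()) , proj₁))
... | no ¬p = contradiction p ¬p
count-remove {suc n} P? {suc v} p with P? zero
... | yes _ = cong suc (count-remove (λ u → P? (suc u)) p)
... | no _  = count-remove (λ u → P? (suc u)) p

2∣n⊎2∣1+n : ∀ n → (2 ∣ n) ⊎ (2 ∣ suc n)
2∣n⊎2∣1+n zero = inj₁ (2 ∣0)
2∣n⊎2∣1+n (suc n) with 2∣n⊎2∣1+n n
... | inj₁ 2∣n   = inj₂ (∣m∣n⇒∣m+n ∣-refl 2∣n)
... | inj₂ 2∣1+n = inj₁ 2∣1+n

2∣1+n⇒¬2∣n : ∀ {n} → 2 ∣ suc n → ¬ 2 ∣ n
2∣1+n⇒¬2∣n {n} 2∣1+n 2∣n with ∣1⇒≡1 (∣m+n∣m⇒∣n (subst (2 ∣_) (+-comm 1 n) 2∣1+n) 2∣n)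
... | ()

¬2∣1+n⇒2∣n : ∀ {n} → ¬ 2 ∣ suc n → 2 ∣ n
¬2∣1+n⇒2∣n {n} ¬2∣1+n with 2∣n⊎2∣1+n n
... | inj₁ 2∣n   = 2∣n
... | inj₂ 2∣1+n = contradiction 2∣1+n ¬2∣1+n

minimal : ∀ {n} {_≺_ : Rel (Fin n) 0ℓ} → WellFounded _≺_ → (∀ u v → Dec (u ≺ v)) →
          ∀ {P : Pred (Fin n) 0ℓ} → Decidable P →
          ∀ {u} → P u → ∃ λ m → P m × (∀ {v} → P v → ¬ v ≺ m)
minimal {_≺_ = _≺_} ≺-wf _≺?_ {P} P? {u} = descend (≺-wf u)
  where
  descend : ∀ {u} → Acc _≺_ u → P u → ∃ λ m → P m × (∀ {v} → P v → ¬ v ≺ m)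
  descend {u} (acc rs) Pu with any? (λ v → P? v ×-dec v ≺? u)
  ... | yes (v , Pv , v≺u) = descend (rs v≺u) Pv
  ... | no ∄v             = u , Pu , λ Pv v≺u → ∄v (_ , Pv , v≺u)

third : (a f : Fin 3) → ∃ λ b → b ≢ a × b ≢ f
third zero             zero             = suc zero       , (λ ()) , (λ ())
third zero             (suc zero)       = suc (suc zero) , (λ ()) , (λ ())
third zero             (suc (suc zero)) = suc zero       , (λ ()) , (λ ())
third (suc zero)       zero             = suc (suc zero) , (λ ()) , (λ ())
third (suc zero)       (suc zero)       = zero           , (λ ()) , (λ ())
third (suc zero)       (suc (suc zero)) = zero           , (λ ()) , (λ ())
third (suc (suc zero)) zero             = suc zero       , (λ ()) , (λ ())
third (suc (suc zero)) (suc zero)       = zero           , (λ ()) , (λ ())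
third (suc (suc zero)) (suc (suc zero)) = zero           , (λ ()) , (λ ())

Edge : ∀ {n} → Graph n → Rel (Fin n) 0ℓ
Edge G u v = adj G u v ≡ true

module _ {n} {G : Graph n} where

  edge-sym : ∀ {u v} → Edge G u v → Edge G v u
  edge-sym {u} {v} e = trans (adj-sym G v u) e

  reach-trans : ∀ {u v w} → Reach G u v → Reach G v w → Reach G u w
  reach-trans here       r′ = r′
  reach-trans (step e r) r′ = step e (reach-trans r r′)

  reach-sym : ∀ {u v} → Reach G u v → Reach G v u
  reach-sym here       = here
  reach-sym (step e r) = reach-trans (reach-sym r) (step (edge-sym e) here)

module _ {n} {P : Pred (Fin n) 0ℓ} (P? : Decidable P) where

  ∈-tabulate⁺ : ∀ {u} → P u → u ∈ₛ tabulate (λ v → does (P? v))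
  ∈-tabulate⁺ {u} Pu = lookup⇒[]= u _ (trans (lookup∘tabulate _ u) (dec-true (P? u) Pu))

  ∈-tabulate⁻ : ∀ {u} → u ∈ₛ tabulate (λ v → does (P? v)) → P u
  ∈-tabulate⁻ {u} u∈ with P? u | trans (sym (lookup∘tabulate (λ v → does (P? v)) u)) ([]=⇒lookup u∈)
  ... | yes Pu | _ = Pu
  ... | no _   | ()

∣tabulate∣≡countB : ∀ {n} (p : Fin n → Bool) → ∣ tabulate p ∣ ≡ countB p
∣tabulate∣≡countB {zero}  p = refl
∣tabulate∣≡countB {suc n} p with p zero
... | true  = cong suc (∣tabulate∣≡countB (λ u → p (suc u)))
... | false = ∣tabulate∣≡countB (λ u → p (suc u))

component-even : ∀ {n} (G : Graph n) → (∀ S → IsComponent G S → 2 ∣ ∣ S ∣) →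
                 ∀ {P : Pred (Fin n) 0ℓ} (P? : Decidable P) → ∃ P →
                 (∀ {u v} → P u → Edge G u v → P v) →
                 (∀ {u v} → P u → P v → Reach G u v) →
                 2 ∣ count P?
component-even G components-even P? (u , Pu) closed connected =
  subst (2 ∣_) (∣tabulate∣≡countB (λ v → does (P? v)))
    (components-even _ (nonempty , closed′ , connected′))
  where
  nonempty   = u , ∈-tabulate⁺ P? Pu
  closed′    = λ u v u∈ e → ∈-tabulate⁺ P? (closed (∈-tabulate⁻ P? u∈) e)
  connected′ = λ u v u∈ v∈ → connected (∈-tabulate⁻ P? u∈) (∈-tabulate⁻ P? v∈)

Umbrella : ∀ {n} → Graph n → Rel (Fin n) 0ℓ → Set
Umbrella G _≺_ = ∀ {i k j} → i ≺ k → k ≺ j → Edge G i j → Edge G i k × Edge G k j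

module UmbrellaOrdering {n} (G : Graph n) {_≺_ : Rel (Fin n) 0ℓ}
  (≺-isStrictTotalOrder : IsStrictTotalOrder _≡_ _≺_) (umbrella : Umbrella G _≺_)
  (components-even : ∀ S → IsComponent G S → 2 ∣ ∣ S ∣) where

  open IsStrictTotalOrder ≺-isStrictTotalOrder
    using (isStrictPartialOrder; compare; irrefl; asym)
    renaming (trans to ≺-trans; _<?_ to _≺?_)

  _~_ : Rel (Fin n) 0ℓ
  _~_ = Edge G

  -- Built from T? so that counting same-coloured neighbours (see OddOn) is definitionally
  -- the count in IsOddColouring.
  _~?_ : ∀ u v → Dec (u ~ v)
  u ~? v = Dec.map T-≡ (T? (adj G u v))

  ~-sym : ∀ {u v} → u ~ v → v ~ u
  ~-sym {u} {v} = edge-sym {G = G} {u} {v}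

  ~-irrefl : ∀ {u} → ¬ u ~ u
  ~-irrefl {u} u~u with trans (sym (adj-irrefl G u)) u~u
  ... | ()

  _≼_ : Rel (Fin n) 0ℓ
  u ≼ v = ¬ v ≺ u

  _≼?_ : ∀ u v → Dec (u ≼ v)
  u ≼? v = ¬? (v ≺? u)

  ≼-refl : ∀ {u} → u ≼ u
  ≼-refl = irrefl refl

  ≺⇒≼ : ∀ {u v} → u ≺ v → u ≼ v
  ≺⇒≼ = asym

  ≼∧≢⇒≺ : ∀ {u v} → u ≼ v → u ≢ v → u ≺ v
  ≼∧≢⇒≺ {u} {v} u≼v u≢v with compare u v
  ... | tri< u≺v _ _ = u≺v
  ... | tri≈ _ u≡v _ = contradiction u≡v u≢v
  ... | tri> _ _ v≺u = contradiction v≺u u≼v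

  ≼-≺-trans : ∀ {u v w} → u ≼ v → v ≺ w → u ≺ w
  ≼-≺-trans {u} {v} u≼v v≺w with u ≟ v
  ... | yes refl = v≺w
  ... | no u≢v   = ≺-trans (≼∧≢⇒≺ u≼v u≢v) v≺w

  min : ∀ {P : Pred (Fin n) 0ℓ} → Decidable P →
        ∀ {u} → P u → ∃ λ m → P m × (∀ {v} → P v → m ≼ v)
  min = minimal (spo-wellFounded isStrictPartialOrder) _≺?_

  max : ∀ {P : Pred (Fin n) 0ℓ} → Decidable P →
        ∀ {u} → P u → ∃ λ m → P m × (∀ {v} → P v → v ≼ m)
  max = minimal (spo-noetherian isStrictPartialOrder) (flip _≺?_)

  UpperNeighbour : Fin n → Pred (Fin n) 0ℓ
  UpperNeighbour x v = x ≺ v × x ~ v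

  upperNeighbour? : ∀ x → Decidable (UpperNeighbour x)
  upperNeighbour? x v = x ≺? v ×-dec x ~? v

  Cut : Pred (Fin n) 0ℓ
  Cut x = ∄ (UpperNeighbour x)

  cut? : Decidable Cut
  cut? x = ¬? (any? (upperNeighbour? x))

  cut-separates : ∀ {x u v} → Cut x → u ≼ x → x ≺ v → ¬ u ~ v
  cut-separates {x} {u} {v} x-cut u≼x x≺v u~v with u ≟ x
  ... | yes refl = x-cut (v , x≺v , u~v)
  ... | no u≢x   = x-cut (v , x≺v , proj₂ (umbrella (≼∧≢⇒≺ u≼x u≢x) x≺v u~v))

  cut-upward-closed : ∀ {y u v} → Cut y → y ≺ u → u ~ v → y ≺ v
  cut-upward-closed {y} {u} {v} y-cut y≺u u~v with y ≺? v
  ... | yes y≺v = y≺v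
  ... | no v≼y  = contradiction (~-sym u~v) (cut-separates y-cut v≼y y≺u)

  segment-even : ∀ {x} → Cut x → ∀ {L : Pred (Fin n) 0ℓ} (L? : Decidable L) → L x →
                 (∀ {u v} → L u → u ~ v → L v) → (∀ {u} → L u → u ≺ x → ¬ Cut u) →
                 2 ∣ count ((_≼? x) ∩? L?)
  segment-even {x} x-cut {L} L? Lx L-closed no-cut-below =
    component-even G components-even ((_≼? x) ∩? L?) (x , ≼-refl , Lx) closed
      (λ p q → reach-trans (reach-top p) (reach-sym (reach-top q)))
    where
    closed : ∀ {u v} → u ≼ x × L u → u ~ v → v ≼ x × L v
    closed (u≼x , Lu) u~v = (λ x≺v → cut-separates x-cut u≼x x≺v u~v) , L-closed Lu u~v

    climb : ∀ {u} → Acc (flip _≺_) u → u ≼ x × L u → Reach G u x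
    climb {u} (acc rs) (u≼x , Lu) with u ≟ x
    ... | yes refl = here
    ... | no u≢x
      with decidable-stable (any? (upperNeighbour? u)) (no-cut-below Lu (≼∧≢⇒≺ u≼x u≢x))
    ...   | v , u≺v , u~v = step u~v (climb (rs u≺v) (closed (u≼x , Lu) u~v))

    reach-top : ∀ {u} → u ≼ x × L u → Reach G u x
    reach-top = climb (spo-noetherian isStrictPartialOrder _)

  -- The vertices between the largest cut y below x and x form a component.
  cut-even : ∀ {x} → Cut x → 2 ∣ count (_≼? x)
  cut-even {x} = go (spo-wellFounded isStrictPartialOrder x)
    where
    go : ∀ {x} → Acc _≺_ x → Cut x → 2 ∣ count (_≼? x)
    go {x} (acc rs) x-cut with any? (λ y → y ≺? x ×-dec cut? y)
    ... | no ∄y = subst (2 ∣_) (count-cong ((_≼? x) ∩? U?) (_≼? x) (proj₁ , (_, _)))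
                    (segment-even x-cut U? _ _ λ _ u≺x u-cut → ∄y (_ , u≺x , u-cut))
    ... | yes (_ , p) with max (λ y → y ≺? x ×-dec cut? y) p
    ...   | y , (y≺x , y-cut) , y-max =
      subst (2 ∣_) (sym (count-split (_≼? x) (y ≺?_))) (∣m∣n⇒∣m+n above-y up-to-y)
      where
      above-y : 2 ∣ count ((_≼? x) ∩? (y ≺?_))
      above-y = segment-even x-cut (y ≺?_) y≺x (cut-upward-closed y-cut)
                  λ y≺u u≺x u-cut → y-max (u≺x , u-cut) y≺u
      up-to-y : 2 ∣ count ((_≼? x) ∩? ∁? (y ≺?_))
      up-to-y = subst (2 ∣_) (count-cong (_≼? y) ((_≼? x) ∩? ∁? (y ≺?_))
                               ((λ u≼y → ≺⇒≼ (≼-≺-trans u≼y y≺x) , u≼y) , proj₂))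
                  (go (rs y≺x) y-cut)

  count-≼≡1+count-≺ : ∀ {s} → count (_≼? s) ≡ suc (count (_≺? s))
  count-≼≡1+count-≺ {s} =
    trans (count-remove (_≼? s) ≼-refl)
          (cong suc (count-cong ((_≼? s) ∩? ∁? (_≟ s)) (_≺? s) (below , below⁻¹)))
    where
    below : (_≼ s) ∩ ∁ (_≡ s) ⊆ (_≺ s)
    below (u≼s , u≢s) = ≼∧≢⇒≺ u≼s u≢s
    below⁻¹ : (_≺ s) ⊆ (_≼ s) ∩ ∁ (_≡ s)
    below⁻¹ u≺s = ≺⇒≼ u≺s , λ { refl → irrefl refl u≺s }

  N⁺ : Fin n → Pred (Fin n) 0ℓ
  N⁺ s u = s ≡ u ⊎ UpperNeighbour s u

  N⁺? : ∀ s → Decidable (N⁺ s)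
  N⁺? s u = s ≟ u ⊎-dec upperNeighbour? s u

  N⁺⇒≼ : ∀ {s u} → N⁺ s u → s ≼ u
  N⁺⇒≼ (inj₁ refl)       = ≼-refl
  N⁺⇒≼ (inj₂ (s≺u , _)) = ≺⇒≼ s≺u

  N⁺-clique : ∀ {s u w} → N⁺ s u → N⁺ s w → u ≢ w → u ~ w
  N⁺-clique (inj₁ refl)       (inj₁ refl)       u≢w = contradiction refl u≢w
  N⁺-clique (inj₁ refl)       (inj₂ (_ , s~w)) _   = s~w
  N⁺-clique (inj₂ (_ , s~u)) (inj₁ refl)       _   = ~-sym s~u
  N⁺-clique {u = u} {w} (inj₂ (s≺u , s~u)) (inj₂ (s≺w , s~w)) u≢w with compare u w
  ... | tri< u≺w _ _ = proj₂ (umbrella s≺u u≺w s~w)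
  ... | tri≈ _ u≡w _ = contradiction u≡w u≢w
  ... | tri> _ _ w≺u = ~-sym (proj₂ (umbrella s≺w w≺u s~u))

  N⁺-initial : ∀ {s u w} → N⁺ s w → s ≼ u → u ≺ w → N⁺ s u
  N⁺-initial {s} {u} Nw s≼u u≺w with s ≟ u | Nw
  ... | yes s≡u | _                 = inj₁ s≡u
  ... | no _    | inj₁ refl         = contradiction u≺w s≼u
  ... | no s≢u  | inj₂ (s≺w , s~w) = inj₂ (s≺u , proj₁ (umbrella s≺u u≺w s~w))
    where s≺u = ≼∧≢⇒≺ s≼u s≢u

  Block : Fin n → Pred (Fin n) 0ℓ
  Block s u = N⁺ s u × (2 ∣ count (N⁺? s) ⊎ ∃ λ w → N⁺ s w × u ≺ w)

  block? : ∀ s → Decidable (Block s)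
  block? s u = N⁺? s u ×-dec (2 ∣? count (N⁺? s) ⊎-dec any? (λ w → N⁺? s w ×-dec u ≺? w))

  N⁺∖block-top : ∀ {s u w} → N⁺ s u → ¬ Block s u → N⁺ s w → w ≼ u
  N⁺∖block-top Nu u∉B Nw u≺w = u∉B (Nu , inj₂ (_ , Nw , u≺w))

  block-clique : ∀ {s u w} → Block s u → Block s w → u ≢ w → u ~ w
  block-clique (Nu , _) (Nw , _) = N⁺-clique Nu Nw

  block-even : ∀ {s} → 2 ∣ count (block? s)
  block-even {s} with 2 ∣? count (N⁺? s)
  ... | yes even = subst (2 ∣_) (count-cong (N⁺? s) (block? s) ((λ Nu → Nu , inj₁ even) , proj₁))
                     even
  ... | no odd with max (N⁺? s) (inj₁ refl)
  ...   | top , N-top , top-max = ¬2∣1+n⇒2∣n (subst (λ k → ¬ 2 ∣ k) size odd)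
    where
    below-top : Block s ≐ N⁺ s ∩ ∁ (_≡ top)
    below-top = (λ { (Nu , inj₁ even)           → contradiction even odd
                   ; (Nu , inj₂ (w , Nw , u≺w)) → Nu , λ { refl → top-max Nw u≺w } })
              , λ (Nu , u≢top) → Nu , inj₂ (top , N-top , ≼∧≢⇒≺ (top-max Nu) u≢top)
    size : count (N⁺? s) ≡ suc (count (block? s))
    size = trans (count-remove (N⁺? s) N-top)
                 (cong suc (sym (count-cong (block? s) (N⁺? s ∩? ∁? (_≟ top)) below-top)))

  block-initial : ∀ {s u w} → Block s u → s ≼ w → ¬ Block s w → u ≺ w
  block-initial {u = u} {w} Bu s≼w w∉B with compare u w
  ... | tri< u≺w _ _  = u≺w
  ... | tri≈ _ refl _ = contradiction Bu w∉B
  ... | tri> _ _ w≺u  = contradiction w≺u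
                          (N⁺∖block-top (N⁺-initial (proj₁ Bu) s≼w w≺u) w∉B (proj₁ Bu))

  start∈block : ∀ {s} → 2 ∣ count (_≺? s) → Block s s
  start∈block {s} even-below with block? s s
  ... | yes s∈B = s∈B
  ... | no s∉B  = contradiction even-below
                    (2∣1+n⇒¬2∣n (subst (2 ∣_) count-≼≡1+count-≺ (cut-even s-cut)))
    where
    s-cut : Cut s
    s-cut (v , s≺v , s~v) = N⁺∖block-top (inj₁ refl) s∉B (inj₂ (s≺v , s~v)) s≺v

  Rest : Fin n → Pred (Fin n) 0ℓ
  Rest s u = s ≼ u × ¬ Block s u

  rest? : ∀ s → Decidable (Rest s)
  rest? s = (s ≼?_) ∩? ∁? (block? s)

  SameColourNeighbour : (Fin n → Fin 3) → Fin n → Pred (Fin n) 0ℓ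
  SameColourNeighbour c v u = v ~ u × c u ≡ c v

  sameColourNeighbour? : ∀ c v → Decidable (SameColourNeighbour c v)
  sameColourNeighbour? c v u = v ~? u ×-dec c u ≟ c v

  OddOn : ∀ {R : Pred (Fin n) 0ℓ} → Decidable R → (Fin n → Fin 3) → Set
  OddOn {R} R? c = ∀ {v} → R v → Odd (count (R? ∩? sameColourNeighbour? c v))

  -- a colours the block of s; f is the colour of the preceding block, whose neighbours
  -- beyond it all lie in N⁺ s.
  record ColouringFrom (s : Fin n) (a f : Fin 3) : Set where
    field
      colour       : Fin n → Fin 3
      odd          : OddOn (s ≼?_) colour
      colour-block : ∀ {u} → Block s u → colour u ≡ a
      avoids       : ∀ {u} → N⁺ s u → colour u ≢ f

  block-odd : ∀ {s a} {c : Fin n → Fin 3} → (∀ {u} → Block s u → c u ≡ a) →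
              (∀ {v u} → Block s v → Rest s u → v ~ u → c u ≢ a) →
              ∀ {v} → Block s v → Odd (count ((s ≼?_) ∩? sameColourNeighbour? c v))
  block-odd {s} {a} {c} c-block c-rest {v} Bv =
    subst Odd (count-cong (block? s ∩? ∁? (_≟ v)) ((s ≼?_) ∩? sameColourNeighbour? c v)
                          (to , from))
      (2∣1+n⇒¬2∣n (subst (2 ∣_) (count-remove (block? s) Bv) block-even))
    where
    to : Block s ∩ ∁ (_≡ v) ⊆ (s ≼_) ∩ SameColourNeighbour c v
    to (Bu , u≢v) = N⁺⇒≼ (proj₁ Bu) , block-clique Bv Bu (u≢v ∘ sym)
                  , trans (c-block Bu) (sym (c-block Bv))
    from : (s ≼_) ∩ SameColourNeighbour c v ⊆ Block s ∩ ∁ (_≡ v)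
    from {u} (s≼u , v~u , cu≡cv) with block? s u
    ... | yes Bu  = Bu , λ { refl → ~-irrefl v~u }
    ... | no u∉B = contradiction (trans cu≡cv (c-block Bv)) (c-rest Bv (s≼u , u∉B) v~u)

  only-block : ∀ {s a f} → a ≢ f → Empty (Rest s) → ColouringFrom s a f
  only-block {s} {a} a≢f no-rest = record
    { colour       = λ _ → a
    ; odd          = λ {v} s≼v →
        block-odd {c = λ _ → a} (λ _ → refl) (λ _ u∈rest _ → contradiction u∈rest (no-rest _))
          (decidable-stable (block? s v) λ v∉B → no-rest v (s≼v , v∉B))
    ; colour-block = λ _ → refl
    ; avoids       = λ _ → a≢f
    }

  module NextBlock {s e} (even-below : 2 ∣ count (_≺? s))
                   (e∈rest : Rest s e) (e-min : ∀ {u} → Rest s u → e ≼ u) where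

    block≺e : ∀ {u} → Block s u → u ≺ e
    block≺e Bu = block-initial Bu (proj₁ e∈rest) (proj₂ e∈rest)

    rest≐from : Rest s ≐ (e ≼_)
    rest≐from = e-min , λ e≼u → (λ u≺s → proj₁ e∈rest (≼-≺-trans e≼u u≺s))
                              , λ Bu → e≼u (block≺e Bu)

    even-below-e : 2 ∣ count (_≺? e)
    even-below-e = subst (2 ∣_) (sym below-e) (∣m∣n⇒∣m+n even-below block-even)
      where
      below-s : (_≺ e) ∩ (_≺ s) ≐ (_≺ s)
      below-s = proj₂ , λ u≺s → ≺-trans u≺s (block≺e (start∈block even-below)) , u≺s
      block : (_≺ e) ∩ ∁ (_≺ s) ≐ Block s
      block = (λ {u} (u≺e , s≼u) → decidable-stable (block? s u) λ u∉B → e-min (s≼u , u∉B) u≺e)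
            , λ Bu → block≺e Bu , N⁺⇒≼ (proj₁ Bu)
      below-e : count (_≺? e) ≡ count (_≺? s) + count (block? s)
      below-e = trans (count-split (_≺? e) (_≺? s))
                      (cong₂ _+_ (count-cong ((_≺? e) ∩? (_≺? s)) (_≺? s) below-s)
                                 (count-cong ((_≺? e) ∩? ∁? (_≺? s)) (block? s) block))

    neighbour∈N⁺ : ∀ {v u} → Block s v → Rest s u → v ~ u → N⁺ e u
    neighbour∈N⁺ {v} {u} Bv u∈rest v~u with e ≟ u
    ... | yes e≡u = inj₁ e≡u
    ... | no e≢u  = inj₂ (e≺u , proj₂ (umbrella (block≺e Bv) e≺u v~u))
      where e≺u = ≼∧≢⇒≺ (e-min u∈rest) e≢u

    N⁺∖block≡e : ∀ {u} → N⁺ s u → ¬ Block s u → u ≡ e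
    N⁺∖block≡e {u} Nu u∉B with e ≟ u
    ... | yes e≡u = sym e≡u
    ... | no e≢u  = contradiction e≺u
                      (N⁺∖block-top (N⁺-initial Nu (proj₁ e∈rest) e≺u) (proj₂ e∈rest) Nu)
      where e≺u = ≼∧≢⇒≺ (e-min (N⁺⇒≼ Nu , u∉B)) e≢u

    module _ {a f b} (a≢f : a ≢ f) (b≢f : b ≢ f) (next : ColouringFrom e b a) where
      open ColouringFrom next
        renaming (colour to c′; odd to c′-odd; colour-block to c′-block; avoids to c′-avoids)

      colour : Fin n → Fin 3
      colour u = if does (block? s u) then a else c′ u

      colour-block : ∀ {u} → Block s u → colour u ≡ a
      colour-block {u} Bu = cong (λ b → if b then a else c′ u) (dec-true (block? s u) Bu)

      colour-rest : ∀ {u} → ¬ Block s u → colour u ≡ c′ u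
      colour-rest {u} u∉B = cong (λ b → if b then a else c′ u) (dec-false (block? s u) u∉B)

      rest-avoids : ∀ {v u} → Block s v → Rest s u → v ~ u → colour u ≢ a
      rest-avoids Bv u∈rest v~u = subst (_≢ a) (sym (colour-rest (proj₂ u∈rest)))
                                    (c′-avoids (neighbour∈N⁺ Bv u∈rest v~u))

      rest-odd : ∀ {v} → Rest s v → Odd (count ((s ≼?_) ∩? sameColourNeighbour? colour v))
      rest-odd {v} v∈rest@(s≼v , v∉B) =
        subst Odd (count-cong ((e ≼?_) ∩? sameColourNeighbour? c′ v)
                              ((s ≼?_) ∩? sameColourNeighbour? colour v) (to , from))
          (c′-odd (proj₁ rest≐from v∈rest))
        where
        to : (e ≼_) ∩ SameColourNeighbour c′ v ⊆ (s ≼_) ∩ SameColourNeighbour colour v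
        to (e≼u , v~u , c′u≡c′v) with proj₂ rest≐from e≼u
        ... | s≼u , u∉B =
          s≼u , v~u , trans (colour-rest u∉B) (trans c′u≡c′v (sym (colour-rest v∉B)))
        from : (s ≼_) ∩ SameColourNeighbour colour v ⊆ (e ≼_) ∩ SameColourNeighbour c′ v
        from {u} (s≼u , v~u , cu≡cv) with block? s u
        ... | yes Bu  = contradiction (trans (sym cu≡cv) (colour-block Bu))
                                      (rest-avoids Bu v∈rest (~-sym v~u))
        ... | no u∉B =
          e-min (s≼u , u∉B) , v~u , trans (sym (colour-rest u∉B)) (trans cu≡cv (colour-rest v∉B))

      avoids : ∀ {u} → N⁺ s u → colour u ≢ f
      avoids {u} Nu with block? s u
      ... | yes Bu  = subst (_≢ f) (sym (colour-block Bu)) a≢f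
      ... | no u∉B = subst (_≢ f) (sym colour≡b) b≢f
        where
        open ≡-Reasoning
        colour≡b : colour u ≡ b
        colour≡b = begin
          colour u ≡⟨ colour-rest u∉B ⟩
          c′ u     ≡⟨ cong c′ (N⁺∖block≡e Nu u∉B) ⟩
          c′ e     ≡⟨ c′-block (start∈block even-below-e) ⟩
          b        ∎

      extend : ColouringFrom s a f
      extend = record
        { colour       = colour
        ; odd          = odd
        ; colour-block = colour-block
        ; avoids       = avoids
        }
        where
        odd : OddOn (s ≼?_) colour
        odd {v} s≼v with block? s v
        ... | yes Bv  = block-odd colour-block rest-avoids Bv
        ... | no v∉B = rest-odd (s≼v , v∉B)

  colouringFrom : ∀ {s} → 2 ∣ count (_≺? s) → ∀ {a f} → a ≢ f → ColouringFrom s a f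
  colouringFrom {s} = go (spo-noetherian isStrictPartialOrder s)
    where
    go : ∀ {s} → Acc (flip _≺_) s → 2 ∣ count (_≺? s) → ∀ {a f} → a ≢ f → ColouringFrom s a f
    go {s} (acc rs) even-below {a} {f} a≢f with any? (rest? s)
    ... | no ∄rest = only-block a≢f (λ u u∈rest → ∄rest (u , u∈rest))
    ... | yes (_ , u∈rest) with min (rest? s) u∈rest | third a f
    ...   | e , e∈rest , e-min | b , b≢a , b≢f =
      extend a≢f b≢f (go (rs (block≺e (start∈block even-below))) even-below-e b≢a)
      where open NextBlock even-below e∈rest e-min

  χodd≤3 : χodd≤ G 3
  χodd≤3 with any? (U? {A = Fin n})
  ... | no ∄v = 3 , ≤-refl , (λ _ → zero) , λ v → contradiction (v , _) ∄v
  ... | yes (u , u∈U) with min U? {u} u∈U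
  ...   | s₀ , _ , s₀-least = 3 , ≤-refl , colour , λ v → subst Odd (from-s₀ v) (odd (s₀-least _))
    where
    nothing-below : 2 ∣ count (_≺? s₀)
    nothing-below = subst (2 ∣_) (sym (count-empty (_≺? s₀) λ v v≺s₀ → s₀-least _ v≺s₀)) (2 ∣0)

    open ColouringFrom (colouringFrom nothing-below {zero} {suc zero} (λ ()))

    from-s₀ : ∀ v → count ((s₀ ≼?_) ∩? sameColourNeighbour? colour v)
                  ≡ count (sameColourNeighbour? colour v)
    from-s₀ v = count-cong ((s₀ ≼?_) ∩? sameColourNeighbour? colour v)
                           (sameColourNeighbour? colour v) (proj₂ , λ {u} p → s₀-least {u} _ , p)

module LeftEndpointOrder {n} (l : Fin n → ℚ) where

  _≺_ : Rel (Fin n) 0ℓ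
  i ≺ j = l i ℚ.< l j ⊎ (l i ≡ l j × i < j)

  ≺-irrefl : Irreflexive _≡_ _≺_
  ≺-irrefl refl (inj₁ li<li)     = ℚP.<-irrefl refl li<li
  ≺-irrefl refl (inj₂ (_ , i<i)) = FinP.<-irrefl refl i<i

  ≺-trans : Transitive _≺_
  ≺-trans (inj₁ li<lj)         (inj₁ lj<lk)         = inj₁ (ℚP.<-trans li<lj lj<lk)
  ≺-trans (inj₁ li<lj)         (inj₂ (lj≡lk , _))   = inj₁ (ℚP.<-respʳ-≡ lj≡lk li<lj)
  ≺-trans (inj₂ (li≡lj , _))   (inj₁ lj<lk)         = inj₁ (ℚP.<-respˡ-≡ (sym li≡lj) lj<lk)
  ≺-trans (inj₂ (li≡lj , i<j)) (inj₂ (lj≡lk , j<k)) =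
    inj₂ (trans li≡lj lj≡lk , FinP.<-trans i<j j<k)

  ≺-compare : Trichotomous _≡_ _≺_
  ≺-compare i j with ×-compare sym ℚP.<-cmp FinP.<-cmp (l i , i) (l j , j)
  ... | tri< i≺j i≉j i⊁j       = tri< i≺j (λ i≡j → i≉j (cong l i≡j , i≡j)) i⊁j
  ... | tri≈ i⊀j (_ , i≡j) i⊁j = tri≈ i⊀j i≡j i⊁j
  ... | tri> i⊀j i≉j i≻j       = tri> i⊀j (λ i≡j → i≉j (cong l i≡j , i≡j)) i≻j

  ≺-isStrictTotalOrder : IsStrictTotalOrder _≡_ _≺_
  ≺-isStrictTotalOrder = record
    { isStrictPartialOrder = record
      { isEquivalence = isEquivalence
      ; irrefl        = ≺-irrefl
      ; trans         = ≺-trans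
      ; <-resp-≈      = resp₂ _≺_
      }
    ; compare = ≺-compare
    }

  ≺⇒≤ : ∀ {i j} → i ≺ j → l i ℚ.≤ l j
  ≺⇒≤ (inj₁ li<lj)       = ℚP.<⇒≤ li<lj
  ≺⇒≤ (inj₂ (li≡lj , _)) = ℚP.≤-reflexive li≡lj

properInterval-umbrella : ∀ {n} {G : Graph n} (rep : IsProperIntervalGraph G) →
                          Umbrella G (LeftEndpointOrder._≺_ (proj₁ rep))
properInterval-umbrella (l , r , l≤r , adj⇔ , proper) {i} {k} {j} i≺k k≺j i~j =
    Equivalence.from (adj⇔ i k)
      ((λ { refl → ≺-irrefl refl i≺k }) , ℚP.≤-trans li≤lk (l≤r k) , ℚP.≤-trans lk≤lj lj≤ri)
  , Equivalence.from (adj⇔ k j)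
      ((λ { refl → ≺-irrefl refl k≺j }) , ℚP.≤-trans lk≤lj (l≤r j) , ℚP.≤-trans lj≤ri ri≤rk)
  where
  open LeftEndpointOrder l
  li≤lk = ≺⇒≤ i≺k
  lk≤lj = ≺⇒≤ k≺j
  lj≤ri = proj₂ (proj₂ (Equivalence.to (adj⇔ i j) i~j))
  ri≤rk : r i ℚ.≤ r k
  ri≤rk with ℚP.≤-total (r i) (r k)
  ... | inj₁ ri≤rk = ri≤rk
  ... | inj₂ rk≤ri = ℚP.≤-reflexive (proj₂ (proper i k li≤lk rk≤ri))

proposition26 : (n : ℕ) (G : Graph n) → IsProperIntervalGraph G →
    (∀ (S : Subset n) → IsComponent G S → 2 ∣ ∣ S ∣) →
    χodd≤ G 3
proposition26 n G rep components-even = χodd≤3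
  where
  open LeftEndpointOrder (proj₁ rep)
  open UmbrellaOrdering G ≺-isStrictTotalOrder (properInterval-umbrella {G = G} rep)
         components-even
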